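{- Let $t\ge 1$ be a square-free odd integer. Then there are infinitely many pairs of positive integers $(m_i,n_i)$ such that for every $i$, both $m_i-2$ and $n_i$ are relatively prime to $2t$, and for all $i\ne j$, $(2^{m_i}t^{n_i}-1)(2^{m_j}t^{n_j}-1)$ is not a perfect square. -}

module Defs where

open import Data.Nat using (ℕ; _*_)
open import Data.Nat.Divisibility using (_∣_)
open import Data.Product using (∃-syntax)
open import Relation.Binary.PropositionalEquality using (_≡_)

SquareFree : ℕ → Set
SquareFree n = ∀ (d : ℕ) → d * d ∣ n → d ≡ 1

IsSquare : ℕ → Set
IsSquare n = ∃[ k ] (k * k ≡ n)

{-# OPTIONS --safe #-}
-- Take mᵢ = nᵢ = 1 + Dᵢ, where D₀ = 2t and Dᵢ₊₁ = Dᵢ (Dᵢ + 1). With the base-2t repunit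
-- R(k) = 1 + 2t + ⋯ + (2t)^(k-1) we have 2^k t^k - 1 = (2t - 1) R(k). Since 2t ∣ Dᵢ, both mᵢ
-- and mᵢ - 2 are coprime to 2t. For i < j we have mᵢ ∣ Dⱼ, and R(m) ∣ R(n) whenever m ∣ n, so
-- R(mᵢ) and R(mⱼ) = 1 + 2t R(Dⱼ) are coprime. As t is odd, R(k) ≡ 3 (mod 4) for k ≥ 2, so R(mᵢ)
-- is not a square; and (2t - 1)² R(mᵢ) R(mⱼ) with coprime factors is a square only if both
-- factors are.
module Submission where

open import Defs
open import Data.Nat using (ℕ; _+_; _*_; _∸_; _^_; _≤_)
open import Data.Nat.Divisibility using (_∣_)
open import Data.Nat.Coprimality using (Coprime)
open import Data.Integer using (+_; _-_; ∣_∣)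
open import Data.Product using (_×_; _,_; ∃-syntax; Σ-syntax)
open import Function.Definitions using (Injective)
open import Relation.Binary.PropositionalEquality using (_≡_; _≢_)
open import Relation.Nullary using (¬_)

open import Data.Nat.Base
  using (zero; suc; pred; _<_; _≤′_; ≤′-refl; ≤′-step; z≤n; s≤s; _%_)
open import Data.Nat.Base using (NonZero; ≢-nonZero; >-nonZero; >-nonZero⁻¹)
open import Data.Nat.Properties
open import Data.Nat.Divisibility
  using (divides; divides-refl; ∣-refl; ∣-trans; ∣-antisym; ∣1⇒≡1; ∣⇒≤; _∣0)
open import Data.Nat.Divisibility using (∣m∣n⇒∣m+n; ∣m+n∣m⇒∣n; n∣m*n; m∣m*n)
open import Data.Nat.DivMod using (_/_; m/n*n≡m; %-distribˡ-*; [m+kn]%n≡m%n; m%n<n)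
open import Data.Nat.GCD
  using (gcd; gcd[m,n]∣m; gcd[m,n]∣n; gcd-greatest; c*gcd[m,n]≡gcd[cm,cn])
open import Data.Nat.GCD using (gcd[m,n]≡0⇒m≡0; gcd[m,n]≡0⇒n≡0)
open import Data.Nat.Coprimality as Coprime using (coprime-divisor; coprime⇒gcd≡1; coprime-/gcd)
open import Data.Nat.GeneralisedArithmetic using (fold)
open import Data.Nat.Tactic.RingSolver using (solve-∀)
open import Data.Product using (proj₁)
open import Function.Base using (_∘_)
open import Relation.Binary.Definitions using (tri<; tri≈; tri>)
open import Relation.Binary.PropositionalEquality
  using (refl; sym; trans; cong; cong₂; subst; module ≡-Reasoning)
open import Relation.Nullary using (yes; no; contradiction)

¬2∣⇒odd : ∀ {n} → ¬ 2 ∣ n → ∃[ w ] n ≡ suc (2 * w)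
¬2∣⇒odd {zero}        ¬2∣n = contradiction (2 ∣0) ¬2∣n
¬2∣⇒odd {suc zero}    _    = 0 , refl
¬2∣⇒odd {suc (suc n)} ¬2∣n with ¬2∣⇒odd (¬2∣n ∘ ∣m∣n⇒∣m+n ∣-refl)
... | w , refl = suc w , cong suc (sym (*-suc 2 w))

^-distrib-* : ∀ m n k → (m * n) ^ k ≡ m ^ k * n ^ k
^-distrib-* m n zero    = refl
^-distrib-* m n (suc k) =
  trans (cong (m * n *_) (^-distrib-* m n k)) (interchange m n (m ^ k) (n ^ k))
  where
  interchange : ∀ a b c d → a * b * (c * d) ≡ a * c * (b * d)
  interchange = solve-∀

coprime-suc : ∀ n → Coprime n (suc n)
coprime-suc n {d} (d∣n , d∣1+n) =
  ∣1⇒≡1 (∣m+n∣m⇒∣n (subst (d ∣_) (+-comm 1 n) d∣1+n) d∣n)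

coprime-∣ˡ : ∀ {d m n} → d ∣ m → Coprime m n → Coprime d n
coprime-∣ˡ d∣m m⊥n (e∣d , e∣n) = m⊥n (∣-trans e∣d d∣m , e∣n)

coprime-∣ʳ : ∀ {d m n} → d ∣ n → Coprime m n → Coprime m d
coprime-∣ʳ d∣n m⊥n = Coprime.sym (coprime-∣ˡ d∣n (Coprime.sym m⊥n))

coprime-*ˡ : ∀ {a b c} → Coprime a c → Coprime b c → Coprime (a * b) c
coprime-*ˡ {a} a⊥c b⊥c {d} (d∣ab , d∣c) = b⊥c (coprime-divisor d⊥a d∣ab , d∣c)
  where
  d⊥a : Coprime d a
  d⊥a (e∣d , e∣a) = a⊥c (e∣a , ∣-trans e∣d d∣c)

coprime-square : ∀ {m n} → Coprime m n → Coprime (m * m) (n * n)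
coprime-square {m} {n} m⊥n = coprime-*ˡ m⊥n² m⊥n²
  where
  m⊥n² : Coprime m (n * n)
  m⊥n² = Coprime.sym (coprime-*ˡ (Coprime.sym m⊥n) (Coprime.sym m⊥n))

-- If n ≥ 1 then ∣ 1 + n - 2 ∣ computes to n - 1.
coprime-∣suc-2∣ : ∀ {d} n .{{_ : NonZero n}} → d ∣ n → Coprime ∣ + suc n - + 2 ∣ d
coprime-∣suc-2∣ (suc k) d∣n = coprime-∣ʳ d∣n (coprime-suc k)

square-injective : ∀ {m n} → m * m ≡ n * n → m ≡ n
square-injective {m} {n} eq with <-cmp m n
... | tri< m<n _ _ = contradiction eq (<⇒≢ (*-mono-< m<n m<n))
... | tri≈ _ m≡n _ = m≡n
... | tri> _ _ m>n = contradiction eq (>⇒≢ (*-mono-< m>n m>n))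

gcd-square : ∀ m n → gcd (m * m) (n * n) ≡ gcd m n * gcd m n
gcd-square m n with gcd m n ≟ 0
... | yes g≡0 rewrite gcd[m,n]≡0⇒m≡0 {m} {n} g≡0 | gcd[m,n]≡0⇒n≡0 m {n} g≡0 = refl
... | no g≢0 = begin
  gcd (m * m) (n * n)
    ≡⟨ cong₂ (λ x y → gcd (x * x) (y * y)) m′*g≡m n′*g≡n ⟨
  gcd ((m′ * g) * (m′ * g)) ((n′ * g) * (n′ * g))
    ≡⟨ cong₂ gcd (rearrange m′ g) (rearrange n′ g) ⟩
  gcd ((g * g) * (m′ * m′)) ((g * g) * (n′ * n′))
    ≡⟨ c*gcd[m,n]≡gcd[cm,cn] (g * g) _ _ ⟨
  (g * g) * gcd (m′ * m′) (n′ * n′)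
    ≡⟨ cong ((g * g) *_) (coprime⇒gcd≡1 (coprime-square (coprime-/gcd m n))) ⟩
  (g * g) * 1
    ≡⟨ *-identityʳ _ ⟩
  g * g ∎
  where
  open ≡-Reasoning
  g = gcd m n
  instance
    g-nonZero : NonZero g
    g-nonZero = ≢-nonZero g≢0
  m′ = m / g
  n′ = n / g
  m′*g≡m : m′ * g ≡ m
  m′*g≡m = m/n*n≡m (gcd[m,n]∣m m n)
  n′*g≡n : n′ * g ≡ n
  n′*g≡n = m/n*n≡m (gcd[m,n]∣n m n)
  rearrange : ∀ a b → (a * b) * (a * b) ≡ (b * b) * (a * a)
  rearrange = solve-∀

square-∣-square⇒∣ : ∀ {m n} → m * m ∣ n * n → m ∣ n
square-∣-square⇒∣ {m} {n} m²∣n² = subst (_∣ n) gcd≡m (gcd[m,n]∣n m n)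
  where
  gcd≡m : gcd m n ≡ m
  gcd≡m = square-injective (trans (sym (gcd-square m n))
                                  (∣-antisym (gcd[m,n]∣m _ _) (gcd-greatest ∣-refl m²∣n²)))

square-coprime-*⇒squareˡ : ∀ {m n} → Coprime m n → IsSquare (m * n) → IsSquare m
square-coprime-*⇒squareˡ {m} {n} m⊥n (k , k²≡mn) = gcd m k , (begin
  gcd m k * gcd m k   ≡⟨ gcd-square m k ⟨
  gcd (m * m) (k * k) ≡⟨ cong (gcd (m * m)) k²≡mn ⟩
  gcd (m * m) (m * n) ≡⟨ c*gcd[m,n]≡gcd[cm,cn] m m n ⟨
  m * gcd m n         ≡⟨ cong (m *_) (coprime⇒gcd≡1 m⊥n) ⟩
  m * 1               ≡⟨ *-identityʳ m ⟩
  m                   ∎)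
  where open ≡-Reasoning

square-*-cancelˡ : ∀ {c n} .{{_ : NonZero c}} → IsSquare (c * c * n) → IsSquare n
square-*-cancelˡ {c} {n} (k , k²≡c²n)
  with square-∣-square⇒∣ {c} {k} (divides n (trans k²≡c²n (*-comm (c * c) n)))
... | divides-refl l =
  l , *-cancelˡ-≡ (l * l) n (c * c) {{m*n≢0 c c}} (trans (rearrange c l) k²≡c²n)
  where
  rearrange : ∀ c l → c * c * (l * l) ≡ l * c * (l * c)
  rearrange = solve-∀

square-%4≢3 : ∀ {n} → IsSquare n → n % 4 ≢ 3
square-%4≢3 (k , refl) k²%4≡3 =
  residue-square (k % 4) (m%n<n k 4) (trans (sym (%-distribˡ-* k k 4)) k²%4≡3)
  where
  residue-square : ∀ r → r < 4 → (r * r) % 4 ≢ 3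
  residue-square 0 _ ()
  residue-square 1 _ ()
  residue-square 2 _ ()
  residue-square 3 _ ()
  residue-square (suc (suc (suc (suc _)))) (s≤s (s≤s (s≤s (s≤s ())))) _

¬square-scaled-coprime : ∀ {c m n} .{{_ : NonZero c}} → Coprime m n → ¬ IsSquare m →
                        ¬ IsSquare ((c * m) * (c * n))
¬square-scaled-coprime {c} {m} {n} m⊥n ¬□m =
  ¬□m ∘ square-coprime-*⇒squareˡ m⊥n ∘ square-*-cancelˡ ∘ subst IsSquare (rearrange c m n)
  where
  rearrange : ∀ c m n → (c * m) * (c * n) ≡ c * c * (m * n)
  rearrange = solve-∀

repunit : ℕ → ℕ → ℕ
repunit b zero    = 0
repunit b (suc n) = 1 + b * repunit b n

^∸1≡pred*repunit : ∀ b n → b ^ n ∸ 1 ≡ pred b * repunit b n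
^∸1≡pred*repunit zero    zero    = refl
^∸1≡pred*repunit zero    (suc n) = refl
^∸1≡pred*repunit (suc c) n       = cong (_∸ 1) (geometric n)
  where
  step : ∀ c r → suc c * (1 + c * r) ≡ 1 + c * (1 + suc c * r)
  step = solve-∀
  geometric : ∀ n → suc c ^ n ≡ 1 + c * repunit (suc c) n
  geometric zero    = cong suc (sym (*-zeroʳ c))
  geometric (suc n) = trans (cong (suc c *_) (geometric n)) (step c (repunit (suc c) n))

repunit-+ : ∀ b m n → repunit b (m + n) ≡ repunit b m + b ^ m * repunit b n
repunit-+ b zero    n = sym (+-identityʳ (repunit b n))
repunit-+ b (suc m) n =
  trans (cong (λ r → 1 + b * r) (repunit-+ b m n)) (step b (repunit b m) (b ^ m) (repunit b n))
  where
  step : ∀ b x p y → 1 + b * (x + p * y) ≡ (1 + b * x) + (b * p) * y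
  step = solve-∀

repunit-∣ : ∀ b {m n} → m ∣ n → repunit b m ∣ repunit b n
repunit-∣ b {m} (divides-refl q) = repunit-∣-* q
  where
  repunit-∣-* : ∀ q → repunit b m ∣ repunit b (q * m)
  repunit-∣-* zero    = _ ∣0
  repunit-∣-* (suc q) = subst (repunit b m ∣_) (sym (repunit-+ b m (q * m)))
                          (∣m∣n⇒∣m+n ∣-refl (∣-trans (repunit-∣-* q) (n∣m*n (b ^ m))))

repunit-coprime : ∀ b {m n} → m ∣ n → Coprime (repunit b m) (repunit b (suc n))
repunit-coprime b {n = n} m∣n =
  coprime-∣ˡ (∣-trans (repunit-∣ b m∣n) (n∣m*n b)) (coprime-suc (b * repunit b n))

-- In base 2t with t odd, 1 + 2t ≡ 3 and (2t)² ≡ 0 modulo 4.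
¬square-repunit-[2*odd] : ∀ {t} → ¬ 2 ∣ t → ∀ {n} → 1 < n → ¬ IsSquare (repunit (2 * t) n)
¬square-repunit-[2*odd] t-odd {suc (suc n)} (s≤s (s≤s z≤n)) □ with ¬2∣⇒odd t-odd
... | w , refl = square-%4≢3 □ (trans (cong (_% 4) (expand w r)) ([m+kn]%n≡m%n 3 k 4))
  where
  r = repunit (2 * suc (2 * w)) n
  k = w + suc (2 * w) * suc (2 * w) * r
  expand : ∀ w r → 1 + 2 * suc (2 * w) * (1 + 2 * suc (2 * w) * r)
                   ≡ 3 + (w + suc (2 * w) * suc (2 * w) * r) * 4
  expand = solve-∀

pronic : ℕ → ℕ
pronic n = n * suc n

fold-∣ : ∀ {f : ℕ → ℕ} z → (∀ n → n ∣ f n) → ∀ {i j} → i ≤′ j → fold z f i ∣ fold z f j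
fold-∣ z n∣fn ≤′-refl        = ∣-refl
fold-∣ z n∣fn (≤′-step i≤′j) = ∣-trans (fold-∣ z n∣fn i≤′j) (n∣fn _)

fold-pronic-∣ : ∀ s {i j} → i ≤ j → fold s pronic i ∣ fold s pronic j
fold-pronic-∣ s i≤j = fold-∣ s (λ n → m∣m*n (suc n)) (≤⇒≤′ i≤j)

suc-fold-pronic-∣ : ∀ s {i j} → i < j → suc (fold s pronic i) ∣ fold s pronic j
suc-fold-pronic-∣ s {i} i<j = ∣-trans (n∣m*n (fold s pronic i)) (fold-pronic-∣ s i<j)

fold-pronic-nonZero : ∀ s .{{_ : NonZero s}} i → NonZero (fold s pronic i)
fold-pronic-nonZero (suc _) zero    = _
fold-pronic-nonZero s       (suc i) = m*n≢0 _ _ {{fold-pronic-nonZero s i}}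

1+n∤n : ∀ {n} .{{_ : NonZero n}} → ¬ suc n ∣ n
1+n∤n = 1+n≰n ∘ ∣⇒≤

fold-pronic-<⇒≢ : ∀ s .{{_ : NonZero s}} {i j} → i < j → fold s pronic i ≢ fold s pronic j
fold-pronic-<⇒≢ s {i} i<j Di≡Dj =
  1+n∤n {{fold-pronic-nonZero s i}}
        (subst (suc (fold s pronic i) ∣_) (sym Di≡Dj) (suc-fold-pronic-∣ s i<j))

fold-pronic-injective : ∀ s .{{_ : NonZero s}} → Injective _≡_ _≡_ (fold s pronic)
fold-pronic-injective s {i} {j} Di≡Dj with <-cmp i j
... | tri< i<j _ _ = contradiction Di≡Dj (fold-pronic-<⇒≢ s i<j)
... | tri≈ _ i≡j _ = i≡j
... | tri> _ _ i>j = contradiction (sym Di≡Dj) (fold-pronic-<⇒≢ s i>j)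

¬square-[2^k*t^k∸1]-pair : ∀ {t m n} → 1 ≤ t → ¬ 2 ∣ t → 1 < m → m ∣ n →
                          ¬ IsSquare ((2 ^ m * t ^ m ∸ 1) * (2 ^ suc n * t ^ suc n ∸ 1))
¬square-[2^k*t^k∸1]-pair {t} {m} {n} 1≤t t-odd 1<m m∣n =
  ¬square-scaled-coprime {{2t∸1-nonZero}} (repunit-coprime (2 * t) m∣n)
                                          (¬square-repunit-[2*odd] t-odd 1<m)
  ∘ subst IsSquare (cong₂ _*_ (2^k*t^k∸1≡ m) (2^k*t^k∸1≡ (suc n)))
  where
  2^k*t^k∸1≡ : ∀ k → 2 ^ k * t ^ k ∸ 1 ≡ pred (2 * t) * repunit (2 * t) k
  2^k*t^k∸1≡ k = trans (cong (_∸ 1) (sym (^-distrib-* 2 t k))) (^∸1≡pred*repunit (2 * t) k)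
  2t∸1-nonZero : NonZero (pred (2 * t))
  2t∸1-nonZero = >-nonZero (<⇒≤pred (*-monoʳ-≤ 2 1≤t))

lemma8p7 : ∀ (t : ℕ) → 1 ≤ t → ¬ (2 ∣ t) → SquareFree t →
    Σ[ m ∈ (ℕ → ℕ) ] Σ[ n ∈ (ℕ → ℕ) ] (Injective {A = ℕ} {B = ℕ × ℕ} _≡_ _≡_ (λ i → (m i , n i))
      × (∀ (i : ℕ) → 1 ≤ m i × 1 ≤ n i
               × Coprime ∣ + m i - + 2 ∣ (2 * t)
               × Coprime (n i) (2 * t))
      × (∀ (i j : ℕ) → i ≢ j →
           ¬ IsSquare (((2 ^ m i) * (t ^ n i) ∸ 1) * ((2 ^ m j) * (t ^ n j) ∸ 1))))
lemma8p7 t 1≤t t-odd _ =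
  a , a , a-injective , (λ i → s≤s z≤n , s≤s z≤n , coprime-∣a-2∣ i , coprime-a i) , ¬square
  where
  instance
    2t-nonZero : NonZero (2 * t)
    2t-nonZero = m*n≢0 2 t {{_}} {{>-nonZero 1≤t}}
  D : ℕ → ℕ
  D = fold (2 * t) pronic
  a : ℕ → ℕ
  a i = suc (D i)
  X : ℕ → ℕ
  X i = 2 ^ a i * t ^ a i ∸ 1
  D-nonZero : ∀ i → NonZero (D i)
  D-nonZero = fold-pronic-nonZero (2 * t)
  2t∣D : ∀ i → 2 * t ∣ D i
  2t∣D i = fold-pronic-∣ (2 * t) {j = i} z≤n
  a-injective : Injective _≡_ _≡_ (λ i → (a i , a i))
  a-injective = fold-pronic-injective (2 * t) ∘ suc-injective ∘ cong proj₁
  coprime-∣a-2∣ : ∀ i → Coprime ∣ + a i - + 2 ∣ (2 * t)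
  coprime-∣a-2∣ i = coprime-∣suc-2∣ (D i) {{D-nonZero i}} (2t∣D i)
  coprime-a : ∀ i → Coprime (a i) (2 * t)
  coprime-a i = coprime-∣ʳ (2t∣D i) (Coprime.sym (coprime-suc (D i)))
  ¬square-< : ∀ {i j} → i < j → ¬ IsSquare (X i * X j)
  ¬square-< {i} i<j = ¬square-[2^k*t^k∸1]-pair 1≤t t-odd (s≤s (>-nonZero⁻¹ (D i) {{D-nonZero i}}))
                                               (suc-fold-pronic-∣ (2 * t) i<j)
  ¬square : ∀ i j → i ≢ j → ¬ IsSquare (X i * X j)
  ¬square i j i≢j with <-cmp i j
  ... | tri< i<j _ _ = ¬square-< i<j
  ... | tri≈ _ i≡j _ = contradiction i≡j i≢j
  ... | tri> _ _ i>j = ¬square-< i>j ∘ subst IsSquare (*-comm (X i) (X j))
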